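{- Let $m \geq 2$ and $n \geq 2$. If $f$ is a maximal IC-coloring of $K_{1(n),m}$, then $f(u) \neq f(v)$ for every pair of distinct vertices $u, v$ of $K_{1(n),m}$.
   Context: All graphs are finite and simple. For a connected graph $G$, a coloring of $G$ is a function $f: V(G) \to \mathbb{N}$ (positive integers); for a subgraph $H$, $f(H) = \sum_{v \in V(H)} f(v)$. $f$ is an IC-coloring if for every integer $k \in \{1, \dots, f(G)\}$ there is an induced connected subgraph $H$ of $G$ with $f(H) = k$. The IC-index $M(G)$ is the maximum of $f(G)$ over all IC-colorings of $G$, and an IC-coloring $f$ with $f(G) = M(G)$ is called a maximal IC-coloring. $K_{1(n),m}$ is the complete multipartite graph with $n$ partite sets of size one and one partite set of size $m$, i.e. the join $O_m \vee K_n$ of an edgeless graph on $m$ vertices with $K_n$. -}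

module Defs where

open import Data.Nat using (ℕ; zero; suc; _+_; _≤_; _<_)
open import Data.Fin using (Fin; toℕ)
open import Data.Fin.Subset using (Subset; _∈_; Nonempty)
open import Data.Vec using (Vec; tabulate; lookup; sum)
open import Data.Bool using (if_then_else_)
open import Data.Product using (Σ; _×_; ∃)
open import Data.Sum using (_⊎_)
open import Relation.Binary.PropositionalEquality using (_≡_; _≢_)

Graph : ℕ → Set₁
Graph N = Fin N → Fin N → Set

-- K_{1(n),m} = O_m ∨ K_n on the vertex set Fin (n + m):
-- vertices with index < n form the clique K_n (singleton partite sets),
-- vertices with index ≥ n form the independent set O_m.
K1nm : (n m : ℕ) → Graph (n + m)
K1nm n m u v = (u ≢ v) × (toℕ u < n ⊎ toℕ v < n)

data Walk {N : ℕ} (G : Graph N) (S : Subset N) : Fin N → Fin N → Set where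
  here : ∀ {u} → u ∈ S → Walk G S u u
  step : ∀ {u w v} → u ∈ S → G u w → Walk G S w v → Walk G S u v

InducedConnected : {N : ℕ} → Graph N → Subset N → Set
InducedConnected {N} G S =
  Nonempty S × (∀ (u v : Fin N) → u ∈ S → v ∈ S → Walk G S u v)

Coloring : ℕ → Set
Coloring N = Fin N → ℕ

IsColoring : {N : ℕ} → Coloring N → Set
IsColoring {N} f = ∀ (v : Fin N) → 1 ≤ f v

weight : {N : ℕ} → Coloring N → Subset N → ℕ
weight {N} f S = sum (tabulate (λ i → if lookup S i then f i else 0))

total : {N : ℕ} → Coloring N → ℕ
total {N} f = sum (tabulate f)

IsICColoring : {N : ℕ} → Graph N → Coloring N → Set
IsICColoring {N} G f =
  IsColoring f ×
  (∀ (k : ℕ) → 1 ≤ k → k ≤ total f →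
     Σ (Subset N) (λ S → InducedConnected G S × weight f S ≡ k))

IsMaximalICColoring : {N : ℕ} → Graph N → Coloring N → Set
IsMaximalICColoring {N} G f =
  IsICColoring G f × (∀ (g : Coloring N) → IsICColoring G g → total g ≤ total f)

-- Every connected set of O_m ∨ K_n either meets K_n or is a single vertex of O_m. If f u = f v
-- with u ≠ v, exchanging v for u does not change the weight of a set, so all realised weights are
-- already realised by the sets meeting K_n that do not contain v without u; the remaining sets meeting
-- K_n, those containing v but not u, are at least m in number and absorb the singletons of O_m. Hence
-- f(G) ≤ (2 ^ n - 1) 2 ^ m. A binary colouring realises every value up to (2 ^ n - 1) 2 ^ m + 1, so f
-- is not maximal.

module Submission where

open import Defs
open import Data.Bool using (Bool; true; false; if_then_else_; _∧_; _∨_)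
open import Data.Bool.Properties using (∨-zeroʳ)
open import Data.Fin using (Fin; zero; suc; toℕ; fromℕ<; combine; _↑ˡ_; _↑ʳ_)
open import Data.Fin.Properties
  using (toℕ<n; toℕ-↑ˡ; toℕ-injective; fromℕ<-injective; combine-injective; injective⇒≤; any?)
  renaming (_≟_ to _≟ᶠ_)
open import Data.Fin.Subset using (Subset; _∈_; _∉_; Nonempty; ⁅_⁆; _∪_; ⊤; ⊥)
open import Data.Fin.Subset.Properties
  using (_∈?_; x∈⁅x⁆; x∈⁅y⁆⇒x≡y; x∈p∪q⁺; x∈p∪q⁻; ⊆-antisym)
open import Data.Nat
  using (ℕ; zero; suc; _+_; _*_; _∸_; _^_; pred; _≤_; _<_; z≤n; s≤s; s≤s⁻¹; _<?_;
         NonZero; >-nonZero)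
open import Data.Nat.DivMod
  using (_%_; _/_; m%n<n; m≡m%n+[m/n]*n; m<n*o⇒m/o<n; [m+kn]%n≡m%n; m<n⇒m%n≡m)
open import Data.Nat.Properties
open import Data.Nat.Solver using (module +-*-Solver)
open import Data.Product using (Σ; ∃; _×_; _,_; proj₁; proj₂)
open import Data.Sum using (_⊎_; inj₁; inj₂)
open import Data.Vec using (Vec; []; _∷_; _++_; lookup; sum; take; drop; _[_]≔_; here; there)
open import Data.Vec.Properties
  using ([]=⇒lookup; lookup⇒[]=; lookup∘update; lookup∘update′; lookup-++ˡ; lookup-++ʳ;
         lookup-++-<; take++drop≡id; tabulate∘lookup; sum-++)
open import Data.Vec.Relation.Unary.All using (All; []; _∷_)
open import Data.Vec.Relation.Unary.All.Properties using (lookup⁺; ++⁺)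
open import Function using (_∘_)
open import Relation.Nullary using (yes; no; contradiction)
open import Relation.Nullary.Decidable using (_×-dec_)
open import Relation.Binary.PropositionalEquality
  using (_≡_; _≢_; refl; sym; trans; cong; cong₂; subst; subst₂; module ≡-Reasoning)

open +-*-Solver

bit : Bool → ℕ
bit b = if b then 1 else 0

fromBits : ∀ {k} → Vec Bool k → ℕ
fromBits []       = 0
fromBits (b ∷ bs) = bit b + 2 * fromBits bs

bit≤1 : ∀ b → bit b ≤ 1
bit≤1 true  = ≤-refl
bit≤1 false = z≤n

bit-surjective : ∀ {r} → r < 2 → ∃ λ b → bit b ≡ r
bit-surjective {0} _ = false , refl
bit-surjective {1} _ = true , refl
bit-surjective {suc (suc _)} (s≤s (s≤s ()))

bit-injective : ∀ {a b} → bit a ≡ bit b → a ≡ b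
bit-injective {true}  {true}  _ = refl
bit-injective {false} {false} _ = refl

bit+2*%2 : ∀ b x → (bit b + 2 * x) % 2 ≡ bit b
bit+2*%2 b x = begin
  (bit b + 2 * x) % 2  ≡⟨ cong (λ y → (bit b + y) % 2) (*-comm 2 x) ⟩
  (bit b + x * 2) % 2  ≡⟨ [m+kn]%n≡m%n (bit b) x 2 ⟩
  bit b % 2            ≡⟨ m<n⇒m%n≡m (s≤s (bit≤1 b)) ⟩
  bit b                ∎
  where open ≡-Reasoning

bit+2*-injective : ∀ a b x y → bit a + 2 * x ≡ bit b + 2 * y → a ≡ b × x ≡ y
bit+2*-injective a b x y eq
  with refl ← bit-injective (trans (sym (bit+2*%2 a x)) (trans (cong (_% 2) eq) (bit+2*%2 b y)))
  = refl , *-cancelˡ-≡ x y 2 (+-cancelˡ-≡ (bit a) _ _ eq)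

bit+2*≥2⇒positive : ∀ b x → 2 ≤ bit b + 2 * x → 0 < x
bit+2*≥2⇒positive _     (suc _) _ = s≤s z≤n
bit+2*≥2⇒positive true  zero    (s≤s ())
bit+2*≥2⇒positive false zero    ()

fromBits<2^ : ∀ {k} (bs : Vec Bool k) → fromBits bs < 2 ^ k
fromBits<2^ []       = s≤s z≤n
fromBits<2^ {suc k} (b ∷ bs) = begin-strict
  bit b + 2 * fromBits bs  ≤⟨ +-monoˡ-≤ _ (bit≤1 b) ⟩
  1 + 2 * fromBits bs      <⟨ n<1+n _ ⟩
  2 + 2 * fromBits bs      ≡⟨ sym (*-suc 2 (fromBits bs)) ⟩
  2 * suc (fromBits bs)    ≤⟨ *-monoʳ-≤ 2 (fromBits<2^ bs) ⟩
  2 * 2 ^ k                ∎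
  where open ≤-Reasoning

fromBits-injective : ∀ {k} (bs cs : Vec Bool k) → fromBits bs ≡ fromBits cs → bs ≡ cs
fromBits-injective []       []       _  = refl
fromBits-injective (b ∷ bs) (c ∷ cs) eq with bit+2*-injective b c _ _ eq
... | refl , rest = cong (b ∷_) (fromBits-injective bs cs rest)

fromBits-surjective : ∀ k {t} → t < 2 ^ k → ∃ λ (bs : Vec Bool k) → fromBits bs ≡ t
fromBits-surjective zero    {zero} _ = [] , refl
fromBits-surjective zero    {suc _} (s≤s ())
fromBits-surjective (suc k) {t} t<2^1+k
  with bit-surjective (m%n<n t 2)
     | fromBits-surjective k (m<n*o⇒m/o<n {t} {2 ^ k} {2} (subst (t <_) (*-comm 2 (2 ^ k)) t<2^1+k))
... | b , b≡t%2 | bs , bs≡t/2 = b ∷ bs , (begin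
  bit b + 2 * fromBits bs  ≡⟨ cong₂ (λ x y → x + 2 * y) b≡t%2 bs≡t/2 ⟩
  t % 2 + 2 * (t / 2)      ≡⟨ cong (t % 2 +_) (*-comm 2 (t / 2)) ⟩
  t % 2 + t / 2 * 2        ≡⟨ sym (m≡m%n+[m/n]*n t 2) ⟩
  t                        ∎)
  where open ≡-Reasoning

fromBits-positive : ∀ {k} {bs : Vec Bool k} → Nonempty bs → 0 < fromBits bs
fromBits-positive (zero , here) = s≤s z≤n
fromBits-positive {bs = b ∷ bs} (suc i , there i∈bs) =
  ≤-trans (fromBits-positive (i , i∈bs)) (≤-trans (m≤m+n _ _) (m≤n+m _ (bit b)))

fromBits-positive⁻¹ : ∀ {k} (bs : Vec Bool k) → 0 < fromBits bs → Nonempty bs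
fromBits-positive⁻¹ (true ∷ _) _ = zero , here
fromBits-positive⁻¹ (false ∷ bs) pos
  with i , i∈bs ← fromBits-positive⁻¹ bs (*-cancelˡ-< 2 0 (fromBits bs) pos)
  = suc i , there i∈bs

suc-fromBits-⊤ : ∀ k → suc (fromBits (⊤ {k})) ≡ 2 ^ k
suc-fromBits-⊤ zero    = refl
suc-fromBits-⊤ (suc k) = trans (sym (*-suc 2 (fromBits (⊤ {k})))) (cong (2 *_) (suc-fromBits-⊤ k))

fromBits-⊤ : ∀ k → fromBits (⊤ {k}) ≡ 2 ^ k ∸ 1
fromBits-⊤ k = trans (sym (m+n∸m≡n 1 _)) (cong (_∸ 1) (suc-fromBits-⊤ k))

select : Bool → ℕ → ℕ
select b x = if b then x else 0

select-∧-∨ : ∀ a b x → select (a ∧ b) x + select (b ∨ a) x ≡ select a x + select b x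
select-∧-∨ true  true  x = refl
select-∧-∨ true  false x = +-comm 0 x
select-∧-∨ false true  x = refl
select-∧-∨ false false x = refl

select≡*bit : ∀ b x → select b x ≡ x * bit b
select≡*bit true  x = sym (*-identityʳ x)
select≡*bit false x = sym (*-zeroʳ x)

weight-⊥ : ∀ {N} (f : Coloring N) → weight f ⊥ ≡ 0
weight-⊥ {zero}  f = refl
weight-⊥ {suc N} f = weight-⊥ (f ∘ suc)

weight-⁅⁆ : ∀ {N} (f : Coloring N) w → weight f ⁅ w ⁆ ≡ f w
weight-⁅⁆ f zero    = trans (cong (f zero +_) (weight-⊥ (f ∘ suc))) (+-identityʳ (f zero))
weight-⁅⁆ f (suc w) = weight-⁅⁆ (f ∘ suc) w

weight-[]≔ : ∀ {N} (f : Coloring N) S j b →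
  weight f (S [ j ]≔ b) + select (lookup S j) (f j) ≡ weight f S + select b (f j)
weight-[]≔ f (x ∷ S) zero b =
  solve 3 (λ y w z → (y :+ w) :+ z := (z :+ w) :+ y) refl
    (select b (f zero)) (weight (f ∘ suc) S) (select x (f zero))
weight-[]≔ f (x ∷ S) (suc j) b = begin
  select x (f zero) + weight (f ∘ suc) (S [ j ]≔ b) + select (lookup S j) (f (suc j))
    ≡⟨ +-assoc (select x (f zero)) _ _ ⟩
  select x (f zero) + (weight (f ∘ suc) (S [ j ]≔ b) + select (lookup S j) (f (suc j)))
    ≡⟨ cong (select x (f zero) +_) (weight-[]≔ (f ∘ suc) S j b) ⟩
  select x (f zero) + (weight (f ∘ suc) S + select b (f (suc j)))
    ≡⟨ sym (+-assoc (select x (f zero)) _ _) ⟩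
  select x (f zero) + weight (f ∘ suc) S + select b (f (suc j))
    ∎
  where open ≡-Reasoning

weight-++ : ∀ {n m} (cs : Vec ℕ n) (ds : Vec ℕ m) xs ys →
  weight (lookup (cs ++ ds)) (xs ++ ys) ≡ weight (lookup cs) xs + weight (lookup ds) ys
weight-++ []       ds []       ys = refl
weight-++ (c ∷ cs) ds (x ∷ xs) ys =
  trans (cong (select x c +_) (weight-++ cs ds xs ys)) (sym (+-assoc (select x c) _ _))

weight-⊤ : ∀ {n} (cs : Vec ℕ n) → weight (lookup cs) ⊤ ≡ sum cs
weight-⊤ []       = refl
weight-⊤ (c ∷ cs) = cong (c +_) (weight-⊤ cs)

total-lookup : ∀ {n} (cs : Vec ℕ n) → total (lookup cs) ≡ sum cs
total-lookup cs = cong sum (tabulate∘lookup cs)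

doublings : ℕ → (k : ℕ) → Vec ℕ k
doublings c zero    = []
doublings c (suc k) = c ∷ doublings (2 * c) k

weight-doublings : ∀ {k} c (xs : Subset k) → weight (lookup (doublings c k)) xs ≡ c * fromBits xs
weight-doublings c []       = sym (*-zeroʳ c)
weight-doublings c (x ∷ xs) = begin
  select x c + weight (lookup (doublings (2 * c) _)) xs
    ≡⟨ cong₂ _+_ (select≡*bit x c) (weight-doublings (2 * c) xs) ⟩
  c * bit x + 2 * c * fromBits xs
    ≡⟨ cong (c * bit x +_) (trans (cong (_* fromBits xs) (*-comm 2 c)) (*-assoc c 2 _)) ⟩
  c * bit x + c * (2 * fromBits xs)
    ≡⟨ *-distribˡ-+ c (bit x) _ ⟨
  c * fromBits (x ∷ xs)
    ∎
  where open ≡-Reasoning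

doublings-positive : ∀ {c} k → 1 ≤ c → All (1 ≤_) (doublings c k)
doublings-positive zero    _   = []
doublings-positive (suc k) 1≤c = 1≤c ∷ doublings-positive k (≤-trans 1≤c (m≤m+n _ _))

_◅◅_ : ∀ {N} {G : Graph N} {S a b c} → Walk G S a b → Walk G S b c → Walk G S a c
here _          ◅◅ q = q
step a∈S ab p   ◅◅ q = step a∈S ab (p ◅◅ q)

walk-source : ∀ {N} {G : Graph N} {S a b} → Walk G S a b → a ∈ S
walk-source (here a∈S)     = a∈S
walk-source (step a∈S _ _) = a∈S

⁅⁆-connected : ∀ {N} (G : Graph N) w → InducedConnected G ⁅ w ⁆
⁅⁆-connected G w = (w , x∈⁅x⁆ w) , λ a b a∈ b∈ →
  subst (Walk G ⁅ w ⁆ a) (trans (x∈⁅y⁆⇒x≡y w a∈) (sym (x∈⁅y⁆⇒x≡y w b∈))) (here a∈)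

MeetsClique : ∀ n {m} → Subset (n + m) → Set
MeetsClique n S = ∃ λ i → toℕ i < n × i ∈ S

meetsClique-++ : ∀ {n m} {xs : Subset n} {ys : Subset m} →
  Nonempty xs → MeetsClique n (xs ++ ys)
meetsClique-++ {n} {m} {xs} {ys} (a , a∈xs) =
  a ↑ˡ m , subst (_< n) (sym (toℕ-↑ˡ a m)) (toℕ<n a) ,
  lookup⇒[]= (a ↑ˡ m) (xs ++ ys) (trans (lookup-++ˡ xs ys a) ([]=⇒lookup a∈xs))

clique≢independent : ∀ {n N} {i j : Fin N} → toℕ i < n → n ≤ toℕ j → i ≢ j
clique≢independent i<n n≤j refl = <⇒≱ i<n n≤j

meetsClique⇒connected : ∀ {n m} {S : Subset (n + m)} →
  MeetsClique n S → InducedConnected (K1nm n m) S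
meetsClique⇒connected {n} {m} {S} (k , k<n , k∈S) = (k , k∈S) , λ a b a∈S b∈S →
  stayOrStep a∈S k∈S (inj₂ k<n) ◅◅ stayOrStep k∈S b∈S (inj₁ k<n)
  where
  stayOrStep : ∀ {a b} → a ∈ S → b ∈ S → toℕ a < n ⊎ toℕ b < n → Walk (K1nm n m) S a b
  stayOrStep {a} {b} a∈S b∈S adj with a ≟ᶠ b
  ... | yes refl = here a∈S
  ... | no a≢b   = step a∈S (a≢b , adj) (here b∈S)

-- In O_m ∨ K_n a connected set avoiding K_n cannot contain an edge.
connected-shape : ∀ {n m} {S : Subset (n + m)} → InducedConnected (K1nm n m) S →
  MeetsClique n S ⊎ ∃ λ w → n ≤ toℕ w × S ≡ ⁅ w ⁆
connected-shape {n} {m} {S} ((x , x∈S) , walk)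
  with any? (λ i → (toℕ i <? n) ×-dec (i ∈? S))
... | yes meets = inj₁ meets
... | no ¬meets = inj₂ (x , ≮⇒≥ (λ x<n → ¬meets (x , x<n , x∈S)) , ⊆-antisym S⊆⁅x⁆ ⁅x⁆⊆S)
  where
  ends-at-x : ∀ {i} → Walk (K1nm n m) S x i → i ≡ x
  ends-at-x (here _)                   = refl
  ends-at-x (step _ (_ , inj₁ x<n) _)  = contradiction (x , x<n , x∈S) ¬meets
  ends-at-x (step _ (_ , inj₂ w<n) p)  = contradiction (_ , w<n , walk-source p) ¬meets
  S⊆⁅x⁆ : ∀ {i} → i ∈ S → i ∈ ⁅ x ⁆
  S⊆⁅x⁆ {i} i∈S = subst (_∈ ⁅ x ⁆) (sym (ends-at-x (walk x i x∈S i∈S))) (x∈⁅x⁆ x)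
  ⁅x⁆⊆S : ∀ {i} → i ∈ ⁅ x ⁆ → i ∈ S
  ⁅x⁆⊆S i∈⁅x⁆ = subst (_∈ S) (sym (x∈⁅y⁆⇒x≡y x i∈⁅x⁆)) x∈S

Realisation : ∀ {N} → Graph N → Coloring N → ℕ → Set
Realisation {N} G f k = Σ (Subset N) λ S → InducedConnected G S × weight f S ≡ k

cliqueMeetingCount : ℕ → ℕ → ℕ
cliqueMeetingCount n m = (2 ^ n ∸ 1) * 2 ^ m

module _ {n m : ℕ} where

  meetsClique⇒take-nonempty : ∀ {S : Subset (n + m)} →
    MeetsClique n S → Nonempty (take n S)
  meetsClique⇒take-nonempty {S} (i , i<n , i∈S) = fromℕ< i<n , lookup⇒[]= _ _ (begin
    lookup (take n S) (fromℕ< i<n)        ≡⟨ sym (lookup-++-< (take n S) (drop n S) i i<n) ⟩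
    lookup (take n S ++ drop n S) i       ≡⟨ cong (λ T → lookup T i) (take++drop≡id n S) ⟩
    lookup S i                            ≡⟨ []=⇒lookup i∈S ⟩
    true                                  ∎)
    where open ≡-Reasoning

  cliqueCode< : (S : Subset (n + m)) → MeetsClique n S → pred (fromBits (take n S)) < 2 ^ n ∸ 1
  cliqueCode< S meets = m+n≤o⇒m≤o∸n _ (begin
    suc (pred F) + 1   ≡⟨ +-comm _ 1 ⟩
    suc (suc (pred F)) ≡⟨ cong suc (suc-pred F {{>-nonZero F>0}}) ⟩
    suc F              ≤⟨ fromBits<2^ (take n S) ⟩
    2 ^ n              ∎)
    where
    open ≤-Reasoning
    F = fromBits (take n S)
    F>0 : 0 < F
    F>0 = fromBits-positive (meetsClique⇒take-nonempty meets)

  -- A set meeting K_n has a nonzero clique part, so only 2 ^ n - 1 clique codes occur.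
  encode : (S : Subset (n + m)) → MeetsClique n S → Fin (cliqueMeetingCount n m)
  encode S meets = combine (fromℕ< (cliqueCode< S meets)) (fromℕ< (fromBits<2^ (drop n S)))

  encode-injective : ∀ {S T} (p : MeetsClique n S) (q : MeetsClique n T) →
    encode S p ≡ encode T q → S ≡ T
  encode-injective {S} {T} p q eq
    with combine-injective (fromℕ< (cliqueCode< S p)) (fromℕ< (fromBits<2^ (drop n S)))
                           (fromℕ< (cliqueCode< T q)) (fromℕ< (fromBits<2^ (drop n T))) eq
  ... | clique≡ , rest≡ = begin
    S                     ≡⟨ sym (take++drop≡id n S) ⟩
    take n S ++ drop n S  ≡⟨ cong₂ _++_ (fromBits-injective (take n S) (take n T) take≡)
                                        (fromBits-injective (drop n S) (drop n T) drop≡) ⟩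
    take n T ++ drop n T  ≡⟨ take++drop≡id n T ⟩
    T                     ∎
    where
    open ≡-Reasoning
    drop≡ : fromBits (drop n S) ≡ fromBits (drop n T)
    drop≡ = fromℕ<-injective _ _ (fromBits<2^ (drop n S)) (fromBits<2^ (drop n T)) rest≡
    take≡ : fromBits (take n S) ≡ fromBits (take n T)
    take≡ = trans (sym (suc-pred _ {{>-nonZero (positive p)}}))
              (trans (cong suc (fromℕ<-injective _ _ (cliqueCode< S p) (cliqueCode< T q) clique≡))
                (suc-pred _ {{>-nonZero (positive q)}}))
      where
      positive : ∀ {R} → MeetsClique n R → 0 < fromBits (take n R)
      positive = fromBits-positive ∘ meetsClique⇒take-nonempty

avoid : ∀ {k} → Fin (suc (suc k)) → Fin (suc (suc k))
avoid zero    = suc zero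
avoid (suc _) = zero

avoid-≢ : ∀ {k} (i : Fin (suc (suc k))) → avoid i ≢ i
avoid-≢ zero    ()
avoid-≢ (suc _) ()

avoid<2 : ∀ {k} (i : Fin (suc (suc k))) → toℕ (avoid i) < 2
avoid<2 zero    = s≤s (s≤s z≤n)
avoid<2 (suc _) = s≤s z≤n

∧⇒∨ : ∀ a b → a ∧ b ≡ true → b ∨ a ≡ true
∧⇒∨ true true _ = refl

module EqualColours (n' m : ℕ) (f : Coloring (2 + n' + m)) (u v : Fin (2 + n' + m))
                    (u≢v : u ≢ v) (fu≡fv : f u ≡ f v)
                    (v-clique⇒u-clique : toℕ v < 2 + n' → toℕ u < 2 + n') where

  private
    n N : ℕ
    n = 2 + n'
    N = n + m

  -- If S contains v but not u, move that element from v to u; otherwise leave S alone.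
  preferU : Subset N → Subset N
  preferU S = (S [ v ]≔ (lookup S v ∧ lookup S u)) [ u ]≔ (lookup S u ∨ lookup S v)

  lookup-preferU-u : ∀ S → lookup (preferU S) u ≡ lookup S u ∨ lookup S v
  lookup-preferU-u S = lookup∘update u (S [ v ]≔ (lookup S v ∧ lookup S u)) _

  lookup-preferU-v : ∀ S → lookup (preferU S) v ≡ lookup S v ∧ lookup S u
  lookup-preferU-v S =
    trans (lookup∘update′ (u≢v ∘ sym) (S [ v ]≔ (lookup S v ∧ lookup S u)) _) (lookup∘update v S _)

  lookup-preferU-other : ∀ S {i} → i ≢ u → i ≢ v → lookup (preferU S) i ≡ lookup S i
  lookup-preferU-other S i≢u i≢v =
    trans (lookup∘update′ i≢u (S [ v ]≔ (lookup S v ∧ lookup S u)) _)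
          (lookup∘update′ i≢v S _)

  weight-preferU : ∀ S → weight f (preferU S) ≡ weight f S
  weight-preferU S = +-cancelʳ-≡ (select a c + select b c) _ _ (begin
    weight f (preferU S) + (select a c + select b c)  ≡⟨ swap-last (weight f (preferU S)) _ _ ⟩
    weight f (preferU S) + select b c + select a c    ≡⟨ cong (_+ select a c) at-u ⟩
    weight f T + select (b ∨ a) c + select a c        ≡⟨ swap-last (weight f T) _ _ ⟨
    weight f T + (select a c + select (b ∨ a) c)      ≡⟨ +-assoc (weight f T) _ _ ⟨
    weight f T + select a c + select (b ∨ a) c        ≡⟨ cong (_+ select (b ∨ a) c) at-v ⟩
    weight f S + select (a ∧ b) c + select (b ∨ a) c  ≡⟨ +-assoc (weight f S) _ _ ⟩
    weight f S + (select (a ∧ b) c + select (b ∨ a) c)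
                                                      ≡⟨ cong (weight f S +_) (select-∧-∨ a b c) ⟩
    weight f S + (select a c + select b c)            ∎)
    where
    open ≡-Reasoning
    a = lookup S v
    b = lookup S u
    c = f v
    T = S [ v ]≔ (a ∧ b)
    at-v : weight f T + select a c ≡ weight f S + select (a ∧ b) c
    at-v = weight-[]≔ f S v (a ∧ b)
    at-u : weight f (preferU S) + select b c ≡ weight f T + select (b ∨ a) c
    at-u = subst₂ (λ y x → weight f (preferU S) + select y x ≡ weight f T + select (b ∨ a) x)
             (lookup∘update′ u≢v S _) fu≡fv (weight-[]≔ f T u (b ∨ a))
    swap-last : ∀ x y z → x + (y + z) ≡ x + z + y
    swap-last x y z = trans (cong (x +_) (+-comm y z)) (sym (+-assoc x z y))

  preferU-v⇒u : ∀ S → v ∈ preferU S → u ∈ preferU S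
  preferU-v⇒u S v∈ = lookup⇒[]= u _ (trans (lookup-preferU-u S)
    (∧⇒∨ (lookup S v) (lookup S u) (trans (sym (lookup-preferU-v S)) ([]=⇒lookup v∈))))

  preferU-meetsClique : ∀ {S} → MeetsClique n S → MeetsClique n (preferU S)
  preferU-meetsClique {S} (i , i<n , i∈S) with i ≟ᶠ u | i ≟ᶠ v
  ... | yes refl | _ = u , i<n , lookup⇒[]= u _ (trans (lookup-preferU-u S)
                         (cong (_∨ lookup S v) ([]=⇒lookup i∈S)))
  ... | no _ | yes refl = u , v-clique⇒u-clique i<n , lookup⇒[]= u _ (trans (lookup-preferU-u S)
                            (trans (cong (lookup S u ∨_) ([]=⇒lookup i∈S)) (∨-zeroʳ (lookup S u))))
  ... | no i≢u | no i≢v = i , i<n , lookup⇒[]= i _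
                            (trans (lookup-preferU-other S i≢u i≢v) ([]=⇒lookup i∈S))

  private
    c₀ c₁ : Fin N
    c₀ = avoid u
    c₁ = avoid c₀

    avoid-clique : ∀ (i : Fin N) → toℕ (avoid i) < n
    avoid-clique i = ≤-trans (avoid<2 i) (m≤m+n 2 n')

  -- A spare set meets K_n and contains v but not u, so it is never of the form preferU S.
  -- The singleton of u (when u lies in O_m) is sent to the spare set {c₀, v, c₁}.
  replaceU : Fin N → Fin N
  replaceU w with w ≟ᶠ u
  ... | yes _ = c₁
  ... | no _  = w

  module _ (w : Fin N) (w-independent : n ≤ toℕ w) where

    replaceU-≢u : replaceU w ≢ u
    replaceU-≢u with w ≟ᶠ u
    ... | yes refl = clique≢independent (avoid-clique c₀) w-independent
    ... | no w≢u   = w≢u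

    replaceU-≢c₀ : replaceU w ≢ c₀
    replaceU-≢c₀ with w ≟ᶠ u
    ... | yes _ = avoid-≢ c₀
    ... | no _  = clique≢independent (avoid-clique u) w-independent ∘ sym

  replaceU-injective : ∀ w₁ w₂ → n ≤ toℕ w₁ → n ≤ toℕ w₂ →
    replaceU w₁ ≡ replaceU w₂ → w₁ ≡ w₂
  replaceU-injective w₁ w₂ ind₁ ind₂ eq with w₁ ≟ᶠ u | w₂ ≟ᶠ u
  ... | yes refl | yes refl = refl
  ... | yes _    | no _     = contradiction eq (clique≢independent (avoid-clique c₀) ind₂)
  ... | no _     | yes _    = contradiction (sym eq) (clique≢independent (avoid-clique c₀) ind₁)
  ... | no _     | no _     = eq

  spareSet : Fin N → Subset N
  spareSet w = ⁅ c₀ ⁆ ∪ ⁅ v ⁆ ∪ ⁅ replaceU w ⁆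

  ∈-spareSet⁻ : ∀ w {x} → x ∈ spareSet w → x ≡ c₀ ⊎ x ≡ v ⊎ x ≡ replaceU w
  ∈-spareSet⁻ w x∈ with x∈p∪q⁻ ⁅ c₀ ⁆ _ x∈
  ... | inj₁ x∈c₀ = inj₁ (x∈⁅y⁆⇒x≡y c₀ x∈c₀)
  ... | inj₂ x∈rest with x∈p∪q⁻ ⁅ v ⁆ ⁅ replaceU w ⁆ x∈rest
  ...   | inj₁ x∈v = inj₂ (inj₁ (x∈⁅y⁆⇒x≡y v x∈v))
  ...   | inj₂ x∈r = inj₂ (inj₂ (x∈⁅y⁆⇒x≡y (replaceU w) x∈r))

  v∈spareSet : ∀ w → v ∈ spareSet w
  v∈spareSet w = x∈p∪q⁺ (inj₂ (x∈p∪q⁺ (inj₁ (x∈⁅x⁆ v))))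

  replaceU∈spareSet : ∀ w → replaceU w ∈ spareSet w
  replaceU∈spareSet w = x∈p∪q⁺ (inj₂ (x∈p∪q⁺ (inj₂ (x∈⁅x⁆ (replaceU w)))))

  spareSet-meetsClique : ∀ w → MeetsClique n (spareSet w)
  spareSet-meetsClique w = c₀ , avoid-clique u , x∈p∪q⁺ (inj₁ (x∈⁅x⁆ c₀))

  u∉spareSet : ∀ w → n ≤ toℕ w → u ∉ spareSet w
  u∉spareSet w ind u∈ with ∈-spareSet⁻ w u∈
  ... | inj₁ u≡c₀        = avoid-≢ u (sym u≡c₀)
  ... | inj₂ (inj₁ u≡v)  = u≢v u≡v
  ... | inj₂ (inj₂ u≡r)  = replaceU-≢u w ind (sym u≡r)

  spareSet-injective : ∀ w₁ w₂ → n ≤ toℕ w₁ → n ≤ toℕ w₂ →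
    spareSet w₁ ≡ spareSet w₂ → w₁ ≡ w₂
  spareSet-injective w₁ w₂ ind₁ ind₂ eq with
    ∈-spareSet⁻ w₂ (subst (replaceU w₁ ∈_) eq (replaceU∈spareSet w₁)) |
    ∈-spareSet⁻ w₁ (subst (replaceU w₂ ∈_) (sym eq) (replaceU∈spareSet w₂))
  ... | inj₁ r₁≡c₀ | _          = contradiction r₁≡c₀ (replaceU-≢c₀ w₁ ind₁)
  ... | _          | inj₁ r₂≡c₀ = contradiction r₂≡c₀ (replaceU-≢c₀ w₂ ind₂)
  ... | inj₂ (inj₂ r₁≡r₂) | _   = replaceU-injective w₁ w₂ ind₁ ind₂ r₁≡r₂
  ... | _ | inj₂ (inj₂ r₂≡r₁)   = replaceU-injective w₁ w₂ ind₁ ind₂ (sym r₂≡r₁)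
  ... | inj₂ (inj₁ r₁≡v) | inj₂ (inj₁ r₂≡v) =
    replaceU-injective w₁ w₂ ind₁ ind₂ (trans r₁≡v (sym r₂≡v))

  Shape : Subset N → Set
  Shape S = MeetsClique n S ⊎ ∃ λ w → n ≤ toℕ w × S ≡ ⁅ w ⁆

  representative : ∀ S → Shape S → Subset N
  representative S (inj₁ _)       = preferU S
  representative S (inj₂ (w , _)) = spareSet w

  representative-meetsClique : ∀ S s → MeetsClique n (representative S s)
  representative-meetsClique S (inj₁ meets)   = preferU-meetsClique meets
  representative-meetsClique S (inj₂ (w , _)) = spareSet-meetsClique w

  representative-injective-weight : ∀ S s T t →
    representative S s ≡ representative T t → weight f S ≡ weight f T
  representative-injective-weight S (inj₁ _) T (inj₁ _) eq =
    trans (sym (weight-preferU S)) (trans (cong (weight f) eq) (weight-preferU T))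
  representative-injective-weight _ (inj₂ (w₁ , ind₁ , refl)) _ (inj₂ (w₂ , ind₂ , refl)) eq =
    cong (weight f ∘ ⁅_⁆) (spareSet-injective w₁ w₂ ind₁ ind₂ eq)
  representative-injective-weight S (inj₁ _) T (inj₂ (w , ind , _)) eq =
    contradiction (subst (u ∈_) eq (preferU-v⇒u S (subst (v ∈_) (sym eq) (v∈spareSet w))))
                  (u∉spareSet w ind)
  representative-injective-weight S (inj₂ (w , ind , _)) T (inj₁ _) eq =
    contradiction (subst (u ∈_) (sym eq) (preferU-v⇒u T (subst (v ∈_) eq (v∈spareSet w))))
                  (u∉spareSet w ind)

  total≤cliqueMeetingCount : IsICColoring (K1nm n m) f → total f ≤ cliqueMeetingCount n m
  total≤cliqueMeetingCount (_ , realise) = injective⇒≤ {f = code} code-injective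
    where
    realisation : ∀ k → Realisation (K1nm n m) f (suc (toℕ k))
    realisation k = realise (suc (toℕ k)) (s≤s z≤n) (toℕ<n k)
    witness : Fin (total f) → Subset N
    witness k = proj₁ (realisation k)
    shape : ∀ k → Shape (witness k)
    shape k = connected-shape (proj₁ (proj₂ (realisation k)))
    weight-witness : ∀ k → weight f (witness k) ≡ suc (toℕ k)
    weight-witness k = proj₂ (proj₂ (realisation k))
    meets : ∀ k → MeetsClique n (representative (witness k) (shape k))
    meets k = representative-meetsClique (witness k) (shape k)
    code : Fin (total f) → Fin (cliqueMeetingCount n m)
    code k = encode (representative (witness k) (shape k)) (meets k)
    code-injective : ∀ {k l} → code k ≡ code l → k ≡ l
    code-injective {k} {l} eq = toℕ-injective (suc-injective (begin
      suc (toℕ k)           ≡⟨ weight-witness k ⟨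
      weight f (witness k)  ≡⟨ representative-injective-weight (witness k) (shape k) (witness l) (shape l)
                                 (encode-injective (meets k) (meets l) eq) ⟩
      weight f (witness l)  ≡⟨ weight-witness l ⟩
      suc (toℕ l)           ∎))
      where open ≡-Reasoning

total≤cliqueMeetingCount : ∀ n' m {f : Coloring (2 + n' + m)} {u v} →
  IsICColoring (K1nm (2 + n') m) f → u ≢ v → f u ≡ f v → total f ≤ cliqueMeetingCount (2 + n') m
total≤cliqueMeetingCount n' m {f} {u} {v} ic u≢v fu≡fv with toℕ v <? 2 + n' | toℕ u <? 2 + n'
... | yes v<n | no _    =
  EqualColours.total≤cliqueMeetingCount n' m f v u (u≢v ∘ sym) (sym fu≡fv) (λ _ → v<n) ic
... | yes _   | yes u<n =
  EqualColours.total≤cliqueMeetingCount n' m f u v u≢v fu≡fv (λ _ → u<n) ic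
... | no v≮n  | _       =
  EqualColours.total≤cliqueMeetingCount n' m f u v u≢v fu≡fv (λ v<n → contradiction v<n v≮n) ic

-- Colour K_n by 2, 4, …, 2 ^ n and O_m by 1 and D, 2D, …, 2 ^ (m - 2) D with D = 2 (2 ^ n - 1):
-- the first independent vertex and the clique together count in binary up to 2 ^ (n + 1) - 1,
-- the remaining independent vertices count in blocks of D.
module BinaryColouring (n' m' : ℕ) where

  private
    n m : ℕ
    n = suc n'
    m = suc m'

  D : ℕ
  D = 2 * (2 ^ n ∸ 1)

  colours : Vec ℕ (n + m)
  colours = doublings 2 n ++ (1 ∷ doublings D m')

  g : Coloring (n + m)
  g = lookup colours

  2^n∸1+1 : 2 ^ n ∸ 1 + 1 ≡ 2 ^ n
  2^n∸1+1 = m∸n+n≡m (m^n>0 2 n)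

  D≥1 : 1 ≤ D
  D≥1 = ≤-trans (m+n≤o⇒m≤o∸n 1 (*-monoʳ-≤ 2 (m^n>0 2 n'))) (m≤m+n _ _)

  instance
    D-nonZero : NonZero D
    D-nonZero = >-nonZero D≥1

  g-isColoring : IsColoring g
  g-isColoring =
    lookup⁺ (++⁺ (doublings-positive n (s≤s z≤n)) (s≤s z≤n ∷ doublings-positive m' D≥1))

  weight-g : ∀ xs e ys → weight g (xs ++ (e ∷ ys)) ≡ fromBits (e ∷ xs) + D * fromBits ys
  weight-g xs e ys = begin
    weight g (xs ++ (e ∷ ys))
      ≡⟨ weight-++ (doublings 2 n) (1 ∷ doublings D m') xs (e ∷ ys) ⟩
    weight (lookup (doublings 2 n)) xs + (bit e + weight (lookup (doublings D m')) ys)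
      ≡⟨ cong₂ (λ x y → x + (bit e + y)) (weight-doublings 2 xs) (weight-doublings D ys) ⟩
    2 * fromBits xs + (bit e + D * fromBits ys)
      ≡⟨ solve 3 (λ x b y → x :+ (b :+ y) := (b :+ x) :+ y) refl (2 * fromBits xs) (bit e) (D * fromBits ys) ⟩
    fromBits (e ∷ xs) + D * fromBits ys
      ∎
    where open ≡-Reasoning

  total-g : total g ≡ suc (cliqueMeetingCount n m)
  total-g = begin
    total g
      ≡⟨ total-lookup colours ⟩
    sum colours
      ≡⟨ sum-++ (doublings 2 n) ⟩
    sum (doublings 2 n) + (1 + sum (doublings D m'))
      ≡⟨ cong₂ (λ x y → x + (1 + y)) (trans (sum-doublings 2 n) (cong (2 *_) (fromBits-⊤ n)))
                                    (sum-doublings D m') ⟩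
    2 * h + (1 + 2 * h * t)
      ≡⟨ solve 2 (λ h t → con 2 :* h :+ (con 1 :+ con 2 :* h :* t) := con 1 :+ h :* (con 2 :* (con 1 :+ t)))
               refl h t ⟩
    suc (h * (2 * suc t))
      ≡⟨ cong (λ x → suc (h * (2 * x))) (suc-fromBits-⊤ m') ⟩
    suc (cliqueMeetingCount n m)
      ∎
    where
    open ≡-Reasoning
    h = 2 ^ n ∸ 1
    t = fromBits (⊤ {m'})
    sum-doublings : ∀ c k → sum (doublings c k) ≡ c * fromBits (⊤ {k})
    sum-doublings c k = trans (sym (weight-⊤ (doublings c k))) (weight-doublings c (⊤ {k}))

  j%D+2<2^[1+n] : ∀ j → j % D + 2 < 2 ^ suc n
  j%D+2<2^[1+n] j = begin-strict
    j % D + 2              <⟨ +-monoˡ-< 2 (m%n<n j D) ⟩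
    D + 2                  ≡⟨ sym (*-distribˡ-+ 2 (2 ^ n ∸ 1) 1) ⟩
    2 * (2 ^ n ∸ 1 + 1)    ≡⟨ cong (2 *_) 2^n∸1+1 ⟩
    2 ^ suc n              ∎
    where open ≤-Reasoning

  j/D<2^m' : ∀ j → 2 + j ≤ total g → j / D < 2 ^ m'
  j/D<2^m' j 2+j≤total = m<n*o⇒m/o<n (begin-strict
    j                           <⟨ s≤s⁻¹ (subst (2 + j ≤_) total-g 2+j≤total) ⟩
    (2 ^ n ∸ 1) * (2 * 2 ^ m')  ≡⟨ solve 2 (λ h p → h :* (con 2 :* p) := p :* (con 2 :* h)) refl
                                          (2 ^ n ∸ 1) (2 ^ m') ⟩
    2 ^ m' * D                  ∎)
    where open ≤-Reasoning

  2+j-realised : ∀ j → 2 + j ≤ total g → Realisation (K1nm n m) g (2 + j)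
  2+j-realised j 2+j≤total
    with fromBits-surjective (suc n) (j%D+2<2^[1+n] j) | fromBits-surjective m' (j/D<2^m' j 2+j≤total)
  ... | e ∷ xs , low≡ | ys , high≡ =
    xs ++ (e ∷ ys) , meetsClique⇒connected (meetsClique-++ (fromBits-positive⁻¹ xs xs>0)) , (begin
      weight g (xs ++ (e ∷ ys))            ≡⟨ weight-g xs e ys ⟩
      fromBits (e ∷ xs) + D * fromBits ys  ≡⟨ cong₂ (λ x y → x + D * y) low≡ high≡ ⟩
      j % D + 2 + D * (j / D)              ≡⟨ solve 3 (λ r d q → r :+ con 2 :+ d :* q := con 2 :+ (r :+ q :* d))
                                                     refl (j % D) D (j / D) ⟩
      2 + (j % D + j / D * D)              ≡⟨ cong (2 +_) (m≡m%n+[m/n]*n j D) ⟨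
      2 + j                                ∎)
    where
    open ≡-Reasoning
    xs>0 : 0 < fromBits xs
    xs>0 = bit+2*≥2⇒positive e (fromBits xs) (subst (2 ≤_) (sym low≡) (m≤n+m 2 (j % D)))

  g-isICColoring : IsICColoring (K1nm n m) g
  g-isICColoring = g-isColoring , realise
    where
    realise : ∀ k → 1 ≤ k → k ≤ total g → Realisation (K1nm n m) g k
    realise 1 _ _ = ⁅ n ↑ʳ zero ⁆ , ⁅⁆-connected (K1nm n m) (n ↑ʳ zero) ,
      trans (weight-⁅⁆ g (n ↑ʳ zero)) (lookup-++ʳ (doublings 2 n) (1 ∷ doublings D m') zero)
    realise (suc (suc j)) _ 2+j≤total = 2+j-realised j 2+j≤total

proposition3p5 : (n m : ℕ) → 2 ≤ m → 2 ≤ n → (f : Coloring (n + m)) →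
    IsMaximalICColoring (K1nm n m) f →
    ∀ (u v : Fin (n + m)) → u ≢ v → f u ≢ f v
proposition3p5 (suc (suc n')) (suc (suc m')) (s≤s (s≤s z≤n)) (s≤s (s≤s z≤n))
               f (f-isIC , maximal) u v u≢v fu≡fv =
  n≮n C (begin-strict
    C        <⟨ n<1+n C ⟩
    suc C    ≡⟨ total-g ⟨
    total g  ≤⟨ maximal g g-isICColoring ⟩
    total f  ≤⟨ total≤cliqueMeetingCount n' (suc (suc m')) f-isIC u≢v fu≡fv ⟩
    C        ∎)
  where
  open BinaryColouring (suc n') (suc m')
  open ≤-Reasoning
  C = cliqueMeetingCount (suc (suc n')) (suc (suc m'))
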